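{- For $n\geq1$ let $a_n=n!\sum_{i=1}^{n-1}\frac{1}{i!}$. For a finite sequence of integer pairs $(n_1,\alpha_1),\dots,(n_p,\alpha_p)$ with $p\geq1$, $n_i\geq2$ and $\alpha_i\geq1$, define recursively $$f\big((n_1,\alpha_1),\dots,(n_p,\alpha_p)\big)=\begin{cases}\alpha_1a_{n_1}&\text{if }p=1,\\ \alpha_1\big[a_{n_1}+n_1!\,f\big((n_2,\alpha_2),\dots,(n_p,\alpha_p)\big)\big]&\text{otherwise.}\end{cases}$$ Then for every $p\geq1$ and all such sequences, $$f\big((n_1,\alpha_1),\dots,(n_p,\alpha_p)\big)\leq(e-1)\prod_{i=1}^p\alpha_i\,n_i!\,\sum_{i=0}^{p-1}\frac{1}{2^i}.$$ -}

module Defs where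

open import Data.Nat as ℕ using (ℕ; zero; suc; _∸_; _!; _^_)
open import Data.Nat.Properties using (_!≢0; m^n≢0)
open import Data.Integer using (+_)
open import Data.Rational using (ℚ; 0ℚ; _+_; _*_; _/_; _≤_; _<_)
open import Data.Product using (_×_; _,_; ∃-syntax)
open import Data.List using (List; []; _∷_)

⟦_⟧ : ℕ → ℚ
⟦ n ⟧ = + n / 1

Σ₁ : ℕ → (ℕ → ℚ) → ℚ
Σ₁ zero    g = 0ℚ
Σ₁ (suc m) g = Σ₁ m g + g (suc m)

Σ₀ : ℕ → (ℕ → ℚ) → ℚ
Σ₀ zero    g = 0ℚ
Σ₀ (suc m) g = Σ₀ m g + g m

invFact : ℕ → ℚ
invFact i = (+ 1 / (i !)) {{i !≢0}}

invPow2 : ℕ → ℚ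
invPow2 i = (+ 1 / (2 ^ i)) {{m^n≢0 2 i}}

a : ℕ → ℚ
a n = ⟦ n ! ⟧ * Σ₁ (n ∸ 1) invFact

-- f((n₁,α₁),…,(n_p,α_p)), the sequence given as first pair and the rest
f : ℕ × ℕ → List (ℕ × ℕ) → ℚ
f (n , α) []       = ⟦ α ⟧ * a n
f (n , α) (q ∷ qs) = ⟦ α ⟧ * (a n + ⟦ n ! ⟧ * f q qs)

len : ℕ × ℕ → List (ℕ × ℕ) → ℕ
len _ qs = suc (Data.List.length qs)
  where import Data.List

prodTerm : ℕ × ℕ → ℕ
prodTerm (n , α) = α ℕ.* (n !)

prodAll : ℕ × ℕ → List (ℕ × ℕ) → ℕ
prodAll q []        = prodTerm q
prodAll q (q' ∷ qs) = prodTerm q ℕ.* prodAll q' qs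

eMinus1Partial : ℕ → ℚ
eMinus1Partial N = Σ₁ N invFact

-- "r ≤ (e - 1) · X" for X ≥ 0: since (e-1)·X is the supremum of the increasing
-- sequence (Σ_{k=1}^N 1/k!)·X, this means: for every ε > 0 some partial sum works.
_≤[e-1]*_ : ℚ → ℚ → Set
r ≤[e-1]* X = ∀ (ε : ℚ) → 0ℚ < ε → ∃[ N ] (r ≤ eMinus1Partial N * X + ε)

Admissible : ℕ × ℕ → Set
Admissible (n , α) = (2 ℕ.≤ n) × (1 ℕ.≤ α)

-- Fix N at least every nᵢ and write S = Σ_{k=1}^{N} 1/k!. Then a_n ≤ n! S for each n = nᵢ, and
-- induction on p gives f ≤ S · ∏ αᵢ nᵢ! · Σ_{i<p} 2⁻ⁱ: in the step, the new summand α₁ n₁! S is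
-- absorbed as the term 2^{-(p-1)} because ∏_{i≥2} αᵢ nᵢ! ≥ 2^{p-1} (every factor is at least 2).
-- Since e - 1 is the supremum of these partial sums S, this is the claimed bound.
module Submission where

open import Defs
open import Data.Nat as ℕ using (ℕ; zero; suc; _!; _^_; _⊔_)
import Data.Nat.Properties as ℕ
open import Data.Nat.Coprimality using (1-coprimeTo) renaming (sym to coprime-sym)
open import Data.Integer as ℤ using (+_)
import Data.Integer.Properties as ℤ
open import Data.Rational
  using (mkℚ; 0ℚ; 1ℚ; _+_; _*_; _/_; _≤_; 1/_; NonNegative; nonNegative; *≤*)
open import Data.Rational.Properties
open import Data.Rational.Solver using (module +-*-Solver)
open import Data.Product using (_×_; _,_)
open import Data.List using (List; []; _∷_)
open import Data.List.Relation.Unary.All using (All; []; _∷_)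
open import Relation.Binary.PropositionalEquality

⟦⟧-normal : ∀ n → ⟦ n ⟧ ≡ mkℚ (+ n) 0 (coprime-sym (1-coprimeTo n))
⟦⟧-normal n = normalize-coprime (coprime-sym (1-coprimeTo n))

⟦⟧-homo-* : ∀ m n → ⟦ m ℕ.* n ⟧ ≡ ⟦ m ⟧ * ⟦ n ⟧
⟦⟧-homo-* m n rewrite ⟦⟧-normal m | ⟦⟧-normal n = cong (_/ 1) (ℤ.pos-* m n)

⟦⟧-mono-≤ : ∀ {m n} → m ℕ.≤ n → ⟦ m ⟧ ≤ ⟦ n ⟧
⟦⟧-mono-≤ {m} {n} m≤n rewrite ⟦⟧-normal m | ⟦⟧-normal n =
  *≤* (ℤ.*-monoʳ-≤-nonNeg (+ 1) (ℤ.+≤+ m≤n))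

⟦⟧-nonNeg : ∀ n → NonNegative ⟦ n ⟧
⟦⟧-nonNeg n = normalize-nonNeg n 1

⟦n⟧*1/n≡1 : ∀ n .{{_ : ℕ.NonZero n}} → ⟦ n ⟧ * (+ 1 / n) ≡ 1ℚ
⟦n⟧*1/n≡1 (suc k) = begin
  ⟦ suc k ⟧ * (+ 1 / suc k) ≡⟨ cong₂ _*_ (⟦⟧-normal (suc k)) (normalize-coprime (1-coprimeTo (suc k))) ⟩
  n′ * 1/ n′                ≡⟨ *-inverseʳ n′ ⟩
  1ℚ                        ∎
  where
  open ≡-Reasoning
  n′ = mkℚ (+ suc k) 0 (coprime-sym (1-coprimeTo (suc k)))

1≤⟦m⟧*1/n : ∀ {m} n .{{_ : ℕ.NonZero n}} → n ℕ.≤ m → 1ℚ ≤ ⟦ m ⟧ * (+ 1 / n)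
1≤⟦m⟧*1/n {m} n n≤m = begin
  1ℚ                  ≡⟨ ⟦n⟧*1/n≡1 n ⟨
  ⟦ n ⟧ * (+ 1 / n)   ≤⟨ *-monoʳ-≤-nonNeg (+ 1 / n) {{normalize-nonNeg 1 n}} (⟦⟧-mono-≤ n≤m) ⟩
  ⟦ m ⟧ * (+ 1 / n)   ∎
  where open ≤-Reasoning

p≤p+q : ∀ p q .{{_ : NonNegative q}} → p ≤ p + q
p≤p+q p q = subst (_≤ p + q) (+-identityʳ p) (+-monoʳ-≤ p (nonNegative⁻¹ q))

Σ₁-nonNeg : ∀ {g} → (∀ i → NonNegative (g i)) → ∀ m → NonNegative (Σ₁ m g)
Σ₁-nonNeg     g≥0 zero    = _
Σ₁-nonNeg {g} g≥0 (suc m) =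
  nonNeg+nonNeg⇒nonNeg (Σ₁ m g) {{Σ₁-nonNeg g≥0 m}} (g (suc m)) {{g≥0 (suc m)}}

Σ₁-mono-≤ : ∀ {g} → (∀ i → NonNegative (g i)) → ∀ {m n} → m ℕ.≤ n → Σ₁ m g ≤ Σ₁ n g
Σ₁-mono-≤ {g} g≥0 m≤n = go (ℕ.≤⇒≤′ m≤n)
  where
  go : ∀ {m n} → m ℕ.≤′ n → Σ₁ m g ≤ Σ₁ n g
  go ℕ.≤′-refl             = ≤-refl
  go (ℕ.≤′-step {n} m≤′n) = ≤-trans (go m≤′n) (p≤p+q (Σ₁ n g) (g (suc n)) {{g≥0 (suc n)}})

invFact-nonNeg : ∀ i → NonNegative (invFact i)
invFact-nonNeg i = normalize-nonNeg 1 (i !) {{i ℕ.!≢0}}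

a≤n!*eMinus1Partial : ∀ {n N} → n ℕ.≤ N → a n ≤ ⟦ n ! ⟧ * eMinus1Partial N
a≤n!*eMinus1Partial {n} n≤N =
  *-monoˡ-≤-nonNeg ⟦ n ! ⟧ {{⟦⟧-nonNeg (n !)}}
    (Σ₁-mono-≤ {invFact} invFact-nonNeg (ℕ.≤-trans (ℕ.m∸n≤m n 1) n≤N))

n≤n! : ∀ n → n ℕ.≤ n !
n≤n! zero    = ℕ.z≤n
n≤n! (suc n) = ℕ.m≤m*n (suc n) (n !) {{n ℕ.!≢0}}

2≤prodTerm : ∀ q → Admissible q → 2 ℕ.≤ prodTerm q
2≤prodTerm (n , α) (2≤n , 1≤α) = ℕ.*-mono-≤ 1≤α (ℕ.≤-trans 2≤n (n≤n! n))

2^len≤prodAll : ∀ q qs → Admissible q → All Admissible qs → 2 ^ len q qs ℕ.≤ prodAll q qs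
2^len≤prodAll q []        adm-q _               = 2≤prodTerm q adm-q
2^len≤prodAll q (q′ ∷ qs) adm-q (adm-q′ ∷ adm) =
  ℕ.*-mono-≤ (2≤prodTerm q adm-q) (2^len≤prodAll q′ qs adm-q′ adm)

open +-*-Solver using (solve; _:=_; _:+_; _:*_; con)

-- The new term A·B·S is absorbed into the extra summand w of the geometric series, as P·w ≥ 1.
recursion-step : ∀ {y x} S A B P s w
  .{{_ : NonNegative S}} .{{_ : NonNegative A}} .{{_ : NonNegative B}} →
  y ≤ B * S → x ≤ S * (P * s) → 1ℚ ≤ P * w → A * (y + B * x) ≤ S * (A * B * P * (s + w))
recursion-step {y} {x} S A B P s w y≤BS x≤SPs 1≤Pw = begin
  A * (y + B * x)
    ≤⟨ *-monoˡ-≤-nonNeg A (+-mono-≤ y≤BS (*-monoˡ-≤-nonNeg B x≤SPs)) ⟩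
  A * (B * S + B * (S * (P * s)))
    ≡⟨ solve 5 (λ A B S P s → A :* (B :* S :+ B :* (S :* (P :* s)))
                              := S :* (A :* B) :* con 1ℚ :+ S :* (A :* B) :* (P :* s))
             refl A B S P s ⟩
  S * (A * B) * 1ℚ + S * (A * B) * (P * s)
    ≤⟨ +-monoˡ-≤ _ (*-monoˡ-≤-nonNeg (S * (A * B)) {{SAB≥0}} 1≤Pw) ⟩
  S * (A * B) * (P * w) + S * (A * B) * (P * s)
    ≡⟨ solve 6 (λ A B S P s w → S :* (A :* B) :* (P :* w) :+ S :* (A :* B) :* (P :* s)
                                := S :* (A :* B :* P :* (s :+ w)))
             refl A B S P s w ⟩
  S * (A * B * P * (s + w)) ∎
  where
  open ≤-Reasoning
  SAB≥0 : NonNegative (S * (A * B))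
  SAB≥0 = nonNeg*nonNeg⇒nonNeg S (A * B) {{nonNeg*nonNeg⇒nonNeg A B}}

maxIndex : ℕ × ℕ → List (ℕ × ℕ) → ℕ
maxIndex (n , _) []       = n
maxIndex (n , _) (q ∷ qs) = n ⊔ maxIndex q qs

f≤eMinus1Partial* : ∀ {N} q qs → Admissible q → All Admissible qs → maxIndex q qs ℕ.≤ N →
  f q qs ≤ eMinus1Partial N * (⟦ prodAll q qs ⟧ * Σ₀ (len q qs) invPow2)
f≤eMinus1Partial* {N} (n , α) [] _ _ n≤N = begin
  ⟦ α ⟧ * a n                          ≤⟨ *-monoˡ-≤-nonNeg ⟦ α ⟧ {{⟦⟧-nonNeg α}} (a≤n!*eMinus1Partial n≤N) ⟩
  ⟦ α ⟧ * (⟦ n ! ⟧ * S)                ≡⟨ solve 3 (λ A B S → A :* (B :* S) := S :* ((A :* B) :* (con 0ℚ :+ con 1ℚ)))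
                                            refl ⟦ α ⟧ ⟦ n ! ⟧ S ⟩
  S * ((⟦ α ⟧ * ⟦ n ! ⟧) * (0ℚ + 1ℚ))  ≡⟨ cong (λ x → S * (x * (0ℚ + 1ℚ))) (⟦⟧-homo-* α (n !)) ⟨
  S * (⟦ α ℕ.* n ! ⟧ * (0ℚ + 1ℚ))      ∎
  where
  open ≤-Reasoning
  S = eMinus1Partial N
f≤eMinus1Partial* {N} (n , α) (q ∷ qs) _ (adm-q ∷ adm) n⊔m≤N = begin
  f (n , α) (q ∷ qs)
    ≤⟨ recursion-step S ⟦ α ⟧ ⟦ n ! ⟧ ⟦ prodAll q qs ⟧ _ _
         {{Σ₁-nonNeg {invFact} invFact-nonNeg N}} {{⟦⟧-nonNeg α}} {{⟦⟧-nonNeg (n !)}}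
         (a≤n!*eMinus1Partial (ℕ.m⊔n≤o⇒m≤o n _ n⊔m≤N))
         (f≤eMinus1Partial* q qs adm-q adm (ℕ.m⊔n≤o⇒n≤o n _ n⊔m≤N))
         (1≤⟦m⟧*1/n (2 ^ len q qs) {{ℕ.m^n≢0 2 (len q qs)}} (2^len≤prodAll q qs adm-q adm)) ⟩
  S * (⟦ α ⟧ * ⟦ n ! ⟧ * ⟦ prodAll q qs ⟧ * Σ₀ (len (n , α) (q ∷ qs)) invPow2)
    ≡⟨ cong (λ x → S * (x * _)) (trans (⟦⟧-homo-* (α ℕ.* n !) _) (cong (_* _) (⟦⟧-homo-* α (n !)))) ⟨
  S * (⟦ prodAll (n , α) (q ∷ qs) ⟧ * Σ₀ (len (n , α) (q ∷ qs)) invPow2) ∎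
  where
  open ≤-Reasoning
  S = eMinus1Partial N

lemma8 : (q : ℕ × ℕ) (qs : List (ℕ × ℕ)) → Admissible q → All Admissible qs →
    f q qs ≤[e-1]* (⟦ prodAll q qs ⟧ * Σ₀ (len q qs) invPow2)
lemma8 q qs adm-q adm ε ε>0 = maxIndex q qs , (begin
  f q qs   ≤⟨ f≤eMinus1Partial* q qs adm-q adm ℕ.≤-refl ⟩
  r        ≤⟨ p≤p+q r ε {{nonNegative (<⇒≤ ε>0)}} ⟩
  r + ε    ∎)
  where
  open ≤-Reasoning
  r = eMinus1Partial (maxIndex q qs) * (⟦ prodAll q qs ⟧ * Σ₀ (len q qs) invPow2)
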